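{- For every set of formulas $\Gamma$ and formula $\varphi$: $\Gamma\vdash_{\mathsf{NeL}+\{\mathrm{I2}\}}\varphi$ iff $\Gamma\models_{\mathfrak{N}_{w}^{\mathrm{I+}}}\varphi$.
   Context: Formulas: built from countably many variables with binary $\otimes,\circ$ and unary ${}^{*}$. Abbreviations (for formulas and algebra elements): $\varphi\Rightarrow\psi:=(\varphi\circ\psi^{*})^{*}$; $\varphi\Leftrightarrow\psi:=(\varphi\Rightarrow\psi)\otimes(\psi\Rightarrow\varphi)$; $\varphi\not\Leftrightarrow\psi:=(\varphi\Leftrightarrow\psi)^{*}$; $\varphi\not\Leftrightarrow\psi\not\Leftrightarrow\chi:=((\varphi\not\Leftrightarrow\psi)\otimes(\varphi\not\Leftrightarrow\chi))\otimes(\psi\not\Leftrightarrow\chi)$. $\mathsf{NeL}$: consequence relation given by derivations from premises and instances of the axiom schemes (A1) $\varphi\Rightarrow\varphi$; (A2) $(\varphi\circ\psi)\Rightarrow(\psi\circ\varphi)$; (A3) $\varphi\Rightarrow\varphi^{**}$; (A4) $(\varphi\Rightarrow\psi)\Rightarrow(\varphi\circ\psi)$; (A5) $(\varphi\otimes\psi)\Leftrightarrow(\psi\otimes\varphi)$; (A6) $((\varphi\otimes\psi)\Rightarrow\chi)\Rightarrow((\varphi\otimes\chi^{*})\Rightarrow\psi^{*})$; (A7) $(\varphi\not\Leftrightarrow\psi\not\Leftrightarrow\chi)\Rightarrow((\varphi\Rightarrow\psi)\Rightarrow((\psi\Rightarrow\chi)\Rightarrow(\varphi\Rightarrow\chi)))$,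 with rules: from $\varphi\Rightarrow\psi,\varphi$ infer $\psi$; from $\varphi,\psi$ infer $\varphi\otimes\psi$; from $\varphi\Leftrightarrow\psi$ and $\chi$ infer $\chi'$ ($\chi'$ from $\chi$ by replacing one or more occurrences of $\varphi$ by $\psi$); from $\varphi\otimes\psi$ infer $\varphi$. $\mathsf{NeL}+\{\mathrm{I2}\}$ additionally has the rule (I2): from $\varphi\Rightarrow\psi^{*}$ and $\varphi\Rightarrow\psi$ infer $\chi$. A weak $\mathcal{N}$-algebra is $\mathbf A=(A,\otimes,\circ,{}^{*})$ with $\otimes,\circ$ commutative, $x^{**}=x$, $(x\otimes y)\circ z=(x\otimes z)\circ y$. With distinct $\mathsf t,\mathsf f\notin A$, $\overline A=A\cup\{\mathsf t,\mathsf f\}$, an $\mathfrak{N}_{w}$-model is $(\mathbf A,\perp,\{\mathsf t,\mathsf f\})$, $\perp\subseteq\overline A\times\overline A$, with for all $x,y,z\in A$: (a) $x\perp x^{*}$; (b) $x\perp y^{*}$ and $y\perp x^{*}$ imply $x=y$; (c) $x\perp y$ iff $x\circ y\perp\mathsf t$; (d) $x\perp\mathsf t$ iff $x^{*}\perp\mathsf f$; (e) $x\perp\mathsf f$ and $y\perp\mathsf f$ iff $x\otimes y\perp\mathsf f$; (f) $(x\circ y^{*})^{*}\perp(x\circ y)^{*}$; (g) $x\perp y$ and $x\perp\mathsf f$ imply $y\perp\mathsf t$; (h) $x\not\Leftrightarrow y\not\Leftrightarrow z\perp((x\Rightarrow y)\Rightarrow((y\Rightarrow z)\Rightarrow(x\Rightarrow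 z)))^{*}$. $\mathfrak{N}_{w}^{\mathrm{I+}}$ is the class of $\mathfrak{N}_{w}$-models such that for all $x,y,z\in A$, $x\perp y^{*}$ and $x\perp y$ imply $x=z$. $F_{\perp}=\{a\in A:a\perp\mathsf f\}$. $\Gamma\models_{\mathcal K}\varphi$ iff there is a finite $\Gamma'\subseteq\Gamma$ such that for every model in $\mathcal K$ and every homomorphism $h$ from formulas to $\mathbf A$, $h(\Gamma')\subseteq F_{\perp}$ implies $h(\varphi)\in F_{\perp}$. -}

module Defs where

open import Data.Nat using (ℕ)
open import Data.Bool using (Bool; true; false; _∨_)
open import Data.List using (List)
open import Data.List.Relation.Unary.All using (All)
open import Data.Product using (_×_; Σ; ∃)
open import Function.Bundles using (_⇔_)
open import Relation.Binary.Structures using (IsEquivalence)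
open import Level using (Level; suc; _⊔_) renaming (zero to lzero)

infixr 6 _⊗_ _∘_
infixr 5 _⇒_ _⇔ᶠ_

data Fm : Set where
  var : ℕ → Fm
  _⊗_ : Fm → Fm → Fm
  _∘_ : Fm → Fm → Fm
  _* : Fm → Fm

_⇒_ : Fm → Fm → Fm
φ ⇒ ψ = (φ ∘ (ψ *)) *

_⇔ᶠ_ : Fm → Fm → Fm
φ ⇔ᶠ ψ = (φ ⇒ ψ) ⊗ (ψ ⇒ φ)

_⇎_ : Fm → Fm → Fm
φ ⇎ ψ = (φ ⇔ᶠ ψ) *

⇎3 : Fm → Fm → Fm → Fm
⇎3 φ ψ χ = ((φ ⇎ ψ) ⊗ (φ ⇎ χ)) ⊗ (ψ ⇎ χ)

-- Replacement: Rep φ ψ b χ χ' means χ' arises from χ by replacing some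
-- (disjoint) occurrences of φ by ψ; b = true iff at least one occurrence
-- was replaced.

data Rep (φ ψ : Fm) : Bool → Fm → Fm → Set where
  keep : ∀ {χ} → Rep φ ψ false χ χ
  here : Rep φ ψ true φ ψ
  cong⊗ : ∀ {b c χ₁ χ₁' χ₂ χ₂'} → Rep φ ψ b χ₁ χ₁' → Rep φ ψ c χ₂ χ₂' →
          Rep φ ψ (b ∨ c) (χ₁ ⊗ χ₂) (χ₁' ⊗ χ₂')
  cong∘ : ∀ {b c χ₁ χ₁' χ₂ χ₂'} → Rep φ ψ b χ₁ χ₁' → Rep φ ψ c χ₂ χ₂' →
          Rep φ ψ (b ∨ c) (χ₁ ∘ χ₂) (χ₁' ∘ χ₂')
  cong* : ∀ {b χ χ'} → Rep φ ψ b χ χ' → Rep φ ψ b (χ *) (χ' *)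

FmSet : Set₁
FmSet = Fm → Set

data _⊢I2_ (Γ : FmSet) : Fm → Set where
  prem : ∀ {φ} → Γ φ → Γ ⊢I2 φ
  A1 : ∀ φ → Γ ⊢I2 (φ ⇒ φ)
  A2 : ∀ φ ψ → Γ ⊢I2 ((φ ∘ ψ) ⇒ (ψ ∘ φ))
  A3 : ∀ φ → Γ ⊢I2 (φ ⇒ ((φ *) *))
  A4 : ∀ φ ψ → Γ ⊢I2 ((φ ⇒ ψ) ⇒ (φ ∘ ψ))
  A5 : ∀ φ ψ → Γ ⊢I2 ((φ ⊗ ψ) ⇔ᶠ (ψ ⊗ φ))
  A6 : ∀ φ ψ χ → Γ ⊢I2 (((φ ⊗ ψ) ⇒ χ) ⇒ ((φ ⊗ (χ *)) ⇒ (ψ *)))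
  A7 : ∀ φ ψ χ → Γ ⊢I2 (⇎3 φ ψ χ ⇒ ((φ ⇒ ψ) ⇒ ((ψ ⇒ χ) ⇒ (φ ⇒ χ))))
  MP : ∀ {φ ψ} → Γ ⊢I2 (φ ⇒ ψ) → Γ ⊢I2 φ → Γ ⊢I2 ψ
  Adj : ∀ {φ ψ} → Γ ⊢I2 φ → Γ ⊢I2 ψ → Γ ⊢I2 (φ ⊗ ψ)
  Repl : ∀ {φ ψ χ χ'} → Γ ⊢I2 (φ ⇔ᶠ ψ) → Γ ⊢I2 χ → Rep φ ψ true χ χ' → Γ ⊢I2 χ'
  Simp : ∀ {φ ψ} → Γ ⊢I2 (φ ⊗ ψ) → Γ ⊢I2 φ
  I2 : ∀ {φ ψ} χ → Γ ⊢I2 (φ ⇒ (ψ *)) → Γ ⊢I2 (φ ⇒ ψ) → Γ ⊢I2 χ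

record WeakNAlgebra : Set₁ where
  infixr 6 _⊗ₐ_ _∘ₐ_
  infix 4 _≈_
  field
    A     : Set
    _≈_   : A → A → Set
    isEq  : IsEquivalence _≈_
    _⊗ₐ_  : A → A → A
    _∘ₐ_  : A → A → A
    _⋆    : A → A
    ⊗-cong : ∀ {x x' y y'} → x ≈ x' → y ≈ y' → (x ⊗ₐ y) ≈ (x' ⊗ₐ y')
    ∘-cong : ∀ {x x' y y'} → x ≈ x' → y ≈ y' → (x ∘ₐ y) ≈ (x' ∘ₐ y')
    ⋆-cong : ∀ {x x'} → x ≈ x' → (x ⋆) ≈ (x' ⋆)
    ⊗-comm : ∀ x y → (x ⊗ₐ y) ≈ (y ⊗ₐ x)
    ∘-comm : ∀ x y → (x ∘ₐ y) ≈ (y ∘ₐ x)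
    ⋆⋆     : ∀ x → ((x ⋆) ⋆) ≈ x
    exch   : ∀ x y z → ((x ⊗ₐ y) ∘ₐ z) ≈ ((x ⊗ₐ z) ∘ₐ y)

  _⇒ₐ_ : A → A → A
  x ⇒ₐ y = (x ∘ₐ (y ⋆)) ⋆

  _⇔ₐ_ : A → A → A
  x ⇔ₐ y = (x ⇒ₐ y) ⊗ₐ (y ⇒ₐ x)

  _⇎ₐ_ : A → A → A
  x ⇎ₐ y = (x ⇔ₐ y) ⋆

  ⇎3ₐ : A → A → A → A
  ⇎3ₐ x y z = ((x ⇎ₐ y) ⊗ₐ (x ⇎ₐ z)) ⊗ₐ (y ⇎ₐ z)

data Ext (A : Set) : Set where
  ⌜_⌝ : A → Ext A
  𝐭 𝐟 : Ext A

data ExtEq {A : Set} (_≈_ : A → A → Set) : Ext A → Ext A → Set where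
  el : ∀ {x y} → x ≈ y → ExtEq _≈_ ⌜ x ⌝ ⌜ y ⌝
  tt : ExtEq _≈_ 𝐭 𝐭
  ff : ExtEq _≈_ 𝐟 𝐟

record NwModel : Set₁ where
  field
    alg : WeakNAlgebra
  open WeakNAlgebra alg public
  field
    _⊥_ : Ext A → Ext A → Set
    ⊥-resp : ∀ {u u' v v'} → ExtEq _≈_ u u' → ExtEq _≈_ v v' → u ⊥ v → u' ⊥ v'
    cond-a : ∀ x → ⌜ x ⌝ ⊥ ⌜ x ⋆ ⌝
    cond-b : ∀ x y → ⌜ x ⌝ ⊥ ⌜ y ⋆ ⌝ → ⌜ y ⌝ ⊥ ⌜ x ⋆ ⌝ → x ≈ y
    cond-c : ∀ x y → (⌜ x ⌝ ⊥ ⌜ y ⌝) ⇔ (⌜ x ∘ₐ y ⌝ ⊥ 𝐭)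
    cond-d : ∀ x → (⌜ x ⌝ ⊥ 𝐭) ⇔ (⌜ x ⋆ ⌝ ⊥ 𝐟)
    cond-e : ∀ x y → ((⌜ x ⌝ ⊥ 𝐟) × (⌜ y ⌝ ⊥ 𝐟)) ⇔ (⌜ x ⊗ₐ y ⌝ ⊥ 𝐟)
    cond-f : ∀ x y → ⌜ (x ∘ₐ (y ⋆)) ⋆ ⌝ ⊥ ⌜ (x ∘ₐ y) ⋆ ⌝
    cond-g : ∀ x y → ⌜ x ⌝ ⊥ ⌜ y ⌝ → ⌜ x ⌝ ⊥ 𝐟 → ⌜ y ⌝ ⊥ 𝐭
    cond-h : ∀ x y z → ⌜ ⇎3ₐ x y z ⌝ ⊥ ⌜ ((x ⇒ₐ y) ⇒ₐ ((y ⇒ₐ z) ⇒ₐ (x ⇒ₐ z))) ⋆ ⌝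

  F⊥ : A → Set
  F⊥ a = ⌜ a ⌝ ⊥ 𝐟

IPlus : NwModel → Set
IPlus M = ∀ x y z → ⌜ x ⌝ ⊥ ⌜ y ⋆ ⌝ → ⌜ x ⌝ ⊥ ⌜ y ⌝ → x ≈ z
  where open NwModel M

record Hom (𝐀 : WeakNAlgebra) : Set where
  open WeakNAlgebra 𝐀
  field
    h   : Fm → A
    h-⊗ : ∀ φ ψ → h (φ ⊗ ψ) ≈ (h φ ⊗ₐ h ψ)
    h-∘ : ∀ φ ψ → h (φ ∘ ψ) ≈ (h φ ∘ₐ h ψ)
    h-* : ∀ φ → h (φ *) ≈ (h φ ⋆)

_⊆fin_ : List Fm → FmSet → Set
Γ' ⊆fin Γ = All Γ Γ'

_⊨I+_ : FmSet → Fm → Set₁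
Γ ⊨I+ φ = Σ (List Fm) λ Γ' → Γ' ⊆fin Γ ×
  ((M : NwModel) → IPlus M → (H : Hom (NwModel.alg M)) →
     All (λ γ → NwModel.F⊥ M (Hom.h H γ)) Γ' → NwModel.F⊥ M (Hom.h H φ))

{-# OPTIONS --safe #-}
-- Soundness: in an N_w^{I+}-model every axiom instance is designated and the
-- rules preserve designation: modus ponens by (g) and (d), replacement because
-- a designated x ⇔ y forces x = y by (b), and (I2) because its premises give
-- x ⊥ y* and x ⊥ y**, so the I+ condition collapses the algebra to a single
-- element, which is designated since every x ⇒ x is.  A derivation uses only
-- finitely many premises, which provides the finite Γ' in the semantic relation.
--
-- Completeness: the Lindenbaum model on formulas modulo Γ-provable equivalence,
-- with x ⊥ y iff Γ ⊢ (x ∘ y)*, x ⊥ 𝐭 iff Γ ⊢ x* and x ⊥ 𝐟 iff Γ ⊢ x, satisfies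
-- (a)–(h) and I+ because these conditions are literally the axioms and rules
-- of NeL + {I2}; the identity valuation then designates exactly the
-- consequences of Γ.
module Submission where

open import Defs
open import Function.Bundles using (_⇔_; mk⇔; module Equivalence)
open import Data.Bool using (true)
open import Data.List using (List; []; _∷_; _++_)
open import Data.List.Membership.Propositional using (_∈_)
open import Data.List.Membership.Propositional.Properties using (∈-++⁺ˡ; ∈-++⁺ʳ)
open import Data.List.Relation.Unary.All as All using (All; []; _∷_)
open import Data.List.Relation.Unary.All.Properties using (++⁺)
open import Data.List.Relation.Unary.Any using (here)
open import Data.Product using (Σ-syntax; _×_; _,_; proj₁)
open import Data.Empty using () renaming (⊥ to Empty)
import Relation.Binary.PropositionalEquality as ≡
open import Relation.Binary.Structures using (IsEquivalence)

open Equivalence using (to; from)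

module DerivedRules (Γ : FmSet) where

  ⇔-mp : ∀ {a b} → Γ ⊢I2 (a ⇔ᶠ b) → Γ ⊢I2 a → Γ ⊢I2 b
  ⇔-mp a⇔b ⊢a = Repl a⇔b ⊢a here

  ⇔-refl : ∀ a → Γ ⊢I2 (a ⇔ᶠ a)
  ⇔-refl a = Adj (A1 a) (A1 a)

  ⇔-sym : ∀ {a b} → Γ ⊢I2 (a ⇔ᶠ b) → Γ ⊢I2 (b ⇔ᶠ a)
  ⇔-sym {a} {b} = ⇔-mp (A5 (a ⇒ b) (b ⇒ a))

  ⇔-trans : ∀ {a b c} → Γ ⊢I2 (a ⇔ᶠ b) → Γ ⊢I2 (b ⇔ᶠ c) → Γ ⊢I2 (a ⇔ᶠ c)
  ⇔-trans a⇔b b⇔c =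
    Repl b⇔c a⇔b (cong⊗ (cong* (cong∘ keep (cong* here))) (cong* (cong∘ here keep)))

  ⇔-rep : ∀ {a b χ χ'} → Γ ⊢I2 (a ⇔ᶠ b) → Rep a b true χ χ' → Γ ⊢I2 (χ ⇔ᶠ χ')
  ⇔-rep {χ = χ} a⇔b r =
    Repl a⇔b (⇔-refl χ) (cong⊗ (cong* (cong∘ keep (cong* r))) (cong* (cong∘ r keep)))

  ⊗-cong : ∀ {a a' b b'} → Γ ⊢I2 (a ⇔ᶠ a') → Γ ⊢I2 (b ⇔ᶠ b') →
           Γ ⊢I2 ((a ⊗ b) ⇔ᶠ (a' ⊗ b'))
  ⊗-cong a⇔a' b⇔b' = ⇔-trans (⇔-rep a⇔a' (cong⊗ here keep)) (⇔-rep b⇔b' (cong⊗ keep here))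

  ∘-cong : ∀ {a a' b b'} → Γ ⊢I2 (a ⇔ᶠ a') → Γ ⊢I2 (b ⇔ᶠ b') →
           Γ ⊢I2 ((a ∘ b) ⇔ᶠ (a' ∘ b'))
  ∘-cong a⇔a' b⇔b' = ⇔-trans (⇔-rep a⇔a' (cong∘ here keep)) (⇔-rep b⇔b' (cong∘ keep here))

  *-cong : ∀ {a a'} → Γ ⊢I2 (a ⇔ᶠ a') → Γ ⊢I2 ((a *) ⇔ᶠ (a' *))
  *-cong a⇔a' = ⇔-rep a⇔a' (cong* here)

  ∘-comm : ∀ a b → Γ ⊢I2 ((a ∘ b) ⇔ᶠ (b ∘ a))
  ∘-comm a b = Adj (A2 a b) (A2 b a)

  *-involutive : ∀ a → Γ ⊢I2 (((a *) *) ⇔ᶠ a)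
  *-involutive a = Adj (⇔-mp (*-cong (∘-comm (a *) ((a *) *))) (A1 (a *))) (A3 a)

  ∘*→⇒* : ∀ {a b} → Γ ⊢I2 ((a ∘ b) *) → Γ ⊢I2 (a ⇒ (b *))
  ∘*→⇒* {a} {b} = ⇔-mp (*-cong (∘-cong (⇔-refl a) (⇔-sym (*-involutive b))))

  -- A6 with χ := z*, after removing double stars and commuting the outer ∘.
  exch-⇒ : ∀ x y z → Γ ⊢I2 (((x ⊗ z) ∘ y) ⇒ ((x ⊗ y) ∘ z))
  exch-⇒ x y z = ⇔-mp (⇔-trans (*-cong (∘-cong premise conclusion)) (*-cong (∘-comm _ _)))
                      (A6 x y (z *))
    where
    premise : Γ ⊢I2 ((((x ⊗ y) ∘ ((z *) *)) *) ⇔ᶠ (((x ⊗ y) ∘ z) *))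
    premise = *-cong (∘-cong (⇔-refl _) (*-involutive z))
    conclusion : Γ ⊢I2 (((((x ⊗ ((z *) *)) ∘ ((y *) *)) *) *) ⇔ᶠ ((x ⊗ z) ∘ y))
    conclusion = ⇔-trans (*-involutive _) (∘-cong (⊗-cong (⇔-refl x) (*-involutive z)) (*-involutive y))

  exch : ∀ x y z → Γ ⊢I2 (((x ⊗ y) ∘ z) ⇔ᶠ ((x ⊗ z) ∘ y))
  exch x y z = Adj (exch-⇒ x z y) (exch-⇒ x y z)

module Lindenbaum (Γ : FmSet) where
  open DerivedRules Γ

  algebra : WeakNAlgebra
  algebra = record
    { A = Fm
    ; _≈_ = λ x y → Γ ⊢I2 (x ⇔ᶠ y)
    ; isEq = record { refl = ⇔-refl _ ; sym = ⇔-sym ; trans = ⇔-trans }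
    ; _⊗ₐ_ = _⊗_
    ; _∘ₐ_ = _∘_
    ; _⋆ = _*
    ; ⊗-cong = ⊗-cong
    ; ∘-cong = ∘-cong
    ; ⋆-cong = *-cong
    ; ⊗-comm = A5
    ; ∘-comm = ∘-comm
    ; ⋆⋆ = *-involutive
    ; exch = exch
    }

  _⊥ᴸ_ : Ext Fm → Ext Fm → Set
  ⌜ x ⌝ ⊥ᴸ ⌜ y ⌝ = Γ ⊢I2 ((x ∘ y) *)
  ⌜ x ⌝ ⊥ᴸ 𝐭 = Γ ⊢I2 (x *)
  ⌜ x ⌝ ⊥ᴸ 𝐟 = Γ ⊢I2 x
  𝐭 ⊥ᴸ _ = Empty
  𝐟 ⊥ᴸ _ = Empty

  ⊥ᴸ-resp : ∀ {u u' v v'} → ExtEq (WeakNAlgebra._≈_ algebra) u u' →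
            ExtEq (WeakNAlgebra._≈_ algebra) v v' → u ⊥ᴸ v → u' ⊥ᴸ v'
  ⊥ᴸ-resp (el x⇔x') (el y⇔y') = ⇔-mp (*-cong (∘-cong x⇔x' y⇔y'))
  ⊥ᴸ-resp (el x⇔x') tt = ⇔-mp (*-cong x⇔x')
  ⊥ᴸ-resp (el x⇔x') ff = ⇔-mp x⇔x'
  ⊥ᴸ-resp tt _ ()
  ⊥ᴸ-resp ff _ ()

  model : NwModel
  model = record
    { alg = algebra
    ; _⊥_ = _⊥ᴸ_
    ; ⊥-resp = ⊥ᴸ-resp
    ; cond-a = A1
    ; cond-b = λ _ _ → Adj
    ; cond-c = λ _ _ → mk⇔ (λ p → p) (λ p → p)
    ; cond-d = λ _ → mk⇔ (λ p → p) (λ p → p)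
    ; cond-e = λ x y → mk⇔ (λ (⊢x , ⊢y) → Adj ⊢x ⊢y)
                           (λ ⊢x⊗y → Simp ⊢x⊗y , Simp (⇔-mp (A5 x y) ⊢x⊗y))
    ; cond-f = A4
    ; cond-g = λ _ _ x⊥y ⊢x → MP (∘*→⇒* x⊥y) ⊢x
    ; cond-h = A7
    }

  model-IPlus : IPlus model
  model-IPlus x _ z x⊥y* x⊥y = I2 (x ⇔ᶠ z) (∘*→⇒* x⊥y) x⊥y*

  identity : Hom algebra
  identity = record
    { h = λ φ → φ
    ; h-⊗ = λ _ _ → ⇔-refl _
    ; h-∘ = λ _ _ → ⇔-refl _
    ; h-* = λ _ → ⇔-refl _
    }

complete : ∀ {Γ φ} → Γ ⊨I+ φ → Γ ⊢I2 φ
complete {Γ} (_ , Γ'⊆Γ , valid) =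
  valid model model-IPlus identity (All.map prem Γ'⊆Γ)
  where open Lindenbaum Γ

FinitelyDerivable : FmSet → Fm → Set
FinitelyDerivable Γ φ = Σ[ Γ' ∈ List Fm ] Γ' ⊆fin Γ × ((_∈ Γ') ⊢I2 φ)

⊢-mono : ∀ {Δ Δ' φ} → (∀ {ψ} → Δ ψ → Δ' ψ) → Δ ⊢I2 φ → Δ' ⊢I2 φ
⊢-mono Δ⊆Δ' (prem p) = prem (Δ⊆Δ' p)
⊢-mono _ (A1 φ) = A1 φ
⊢-mono _ (A2 φ ψ) = A2 φ ψ
⊢-mono _ (A3 φ) = A3 φ
⊢-mono _ (A4 φ ψ) = A4 φ ψ
⊢-mono _ (A5 φ ψ) = A5 φ ψ
⊢-mono _ (A6 φ ψ χ) = A6 φ ψ χ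
⊢-mono _ (A7 φ ψ χ) = A7 φ ψ χ
⊢-mono Δ⊆Δ' (MP d e) = MP (⊢-mono Δ⊆Δ' d) (⊢-mono Δ⊆Δ' e)
⊢-mono Δ⊆Δ' (Adj d e) = Adj (⊢-mono Δ⊆Δ' d) (⊢-mono Δ⊆Δ' e)
⊢-mono Δ⊆Δ' (Repl d e r) = Repl (⊢-mono Δ⊆Δ' d) (⊢-mono Δ⊆Δ' e) r
⊢-mono Δ⊆Δ' (Simp d) = Simp (⊢-mono Δ⊆Δ' d)
⊢-mono Δ⊆Δ' (I2 χ d e) = I2 χ (⊢-mono Δ⊆Δ' d) (⊢-mono Δ⊆Δ' e)

module _ {Γ : FmSet} where

  finitely-axiom : ∀ {φ} → (∀ {Δ} → Δ ⊢I2 φ) → FinitelyDerivable Γ φ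
  finitely-axiom ax = [] , [] , ax

  finitely-rule : ∀ {φ ψ χ} → (∀ {Δ} → Δ ⊢I2 φ → Δ ⊢I2 ψ → Δ ⊢I2 χ) →
                  FinitelyDerivable Γ φ → FinitelyDerivable Γ ψ → FinitelyDerivable Γ χ
  finitely-rule rule (Γ₁ , Γ₁⊆Γ , d) (Γ₂ , Γ₂⊆Γ , e) =
    Γ₁ ++ Γ₂ , ++⁺ Γ₁⊆Γ Γ₂⊆Γ , rule (⊢-mono ∈-++⁺ˡ d) (⊢-mono (∈-++⁺ʳ Γ₁) e)

  ⊢-finite : ∀ {φ} → Γ ⊢I2 φ → FinitelyDerivable Γ φ
  ⊢-finite (prem {φ} p) = φ ∷ [] , p ∷ [] , prem (here ≡.refl)
  ⊢-finite (A1 φ) = finitely-axiom (A1 φ)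
  ⊢-finite (A2 φ ψ) = finitely-axiom (A2 φ ψ)
  ⊢-finite (A3 φ) = finitely-axiom (A3 φ)
  ⊢-finite (A4 φ ψ) = finitely-axiom (A4 φ ψ)
  ⊢-finite (A5 φ ψ) = finitely-axiom (A5 φ ψ)
  ⊢-finite (A6 φ ψ χ) = finitely-axiom (A6 φ ψ χ)
  ⊢-finite (A7 φ ψ χ) = finitely-axiom (A7 φ ψ χ)
  ⊢-finite (MP d e) = finitely-rule MP (⊢-finite d) (⊢-finite e)
  ⊢-finite (Adj d e) = finitely-rule Adj (⊢-finite d) (⊢-finite e)
  ⊢-finite (Repl d e r) = finitely-rule (λ d' e' → Repl d' e' r) (⊢-finite d) (⊢-finite e)
  ⊢-finite (Simp d) with ⊢-finite d
  ... | Γ' , Γ'⊆Γ , d' = Γ' , Γ'⊆Γ , Simp d'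
  ⊢-finite (I2 χ d e) = finitely-rule (I2 χ) (⊢-finite d) (⊢-finite e)

module Designation (M : NwModel) where
  open NwModel M
  open IsEquivalence isEq

  F⊥-resp : ∀ {x y} → x ≈ y → F⊥ x → F⊥ y
  F⊥-resp x≈y = ⊥-resp (el x≈y) ff

  ⇒-intro : ∀ {x y} → ⌜ x ⌝ ⊥ ⌜ y ⋆ ⌝ → F⊥ (x ⇒ₐ y)
  ⇒-intro x⊥y* = to (cond-d _) (to (cond-c _ _) x⊥y*)

  ⇒-elim : ∀ {x y} → F⊥ (x ⇒ₐ y) → ⌜ x ⌝ ⊥ ⌜ y ⋆ ⌝
  ⇒-elim x⇒y = from (cond-c _ _) (from (cond-d _) x⇒y)

  ⇒-mp : ∀ {x y} → F⊥ (x ⇒ₐ y) → F⊥ x → F⊥ y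
  ⇒-mp x⇒y x = F⊥-resp (⋆⋆ _) (to (cond-d _) (cond-g _ _ (⇒-elim x⇒y) x))

  ≈→F⊥-⇒ₐ : ∀ {x y} → x ≈ y → F⊥ (x ⇒ₐ y)
  ≈→F⊥-⇒ₐ x≈y = ⇒-intro (⊥-resp (el refl) (el (⋆-cong x≈y)) (cond-a _))

  F⊥-⇔ₐ→≈ : ∀ {x y} → F⊥ (x ⇔ₐ y) → x ≈ y
  F⊥-⇔ₐ→≈ {x} {y} x⇔y with from (cond-e _ _) x⇔y
  ... | x⇒y , y⇒x = cond-b x y (⇒-elim x⇒y) (⇒-elim y⇒x)

  I+-explosion : IPlus M → ∀ {x y} → F⊥ (x ⇒ₐ (y ⋆)) → F⊥ (x ⇒ₐ y) → ∀ z → F⊥ z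
  I+-explosion ipM {x} {y} x⇒y* x⇒y z =
    F⊥-resp (trans (sym (x≈ (x ⇒ₐ x))) (x≈ z)) (≈→F⊥-⇒ₐ refl)
    where
    x≈ : ∀ w → x ≈ w
    x≈ w = ipM x (y ⋆) w (⇒-elim x⇒y*) (⇒-elim x⇒y)

module Soundness (M : NwModel) (ipM : IPlus M) (H : Hom (NwModel.alg M)) where
  open NwModel M
  open IsEquivalence isEq
  open Hom H
  open Designation M

  ⟦_⟧ : Fm → A
  ⟦ var n ⟧ = h (var n)
  ⟦ a ⊗ b ⟧ = ⟦ a ⟧ ⊗ₐ ⟦ b ⟧
  ⟦ a ∘ b ⟧ = ⟦ a ⟧ ∘ₐ ⟦ b ⟧
  ⟦ a * ⟧ = ⟦ a ⟧ ⋆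

  h≈⟦⟧ : ∀ φ → h φ ≈ ⟦ φ ⟧
  h≈⟦⟧ (var n) = refl
  h≈⟦⟧ (a ⊗ b) = trans (h-⊗ a b) (⊗-cong (h≈⟦⟧ a) (h≈⟦⟧ b))
  h≈⟦⟧ (a ∘ b) = trans (h-∘ a b) (∘-cong (h≈⟦⟧ a) (h≈⟦⟧ b))
  h≈⟦⟧ (a *) = trans (h-* a) (⋆-cong (h≈⟦⟧ a))

  ⟦⟧-rep : ∀ {φ ψ b χ χ'} → Rep φ ψ b χ χ' → ⟦ φ ⟧ ≈ ⟦ ψ ⟧ → ⟦ χ ⟧ ≈ ⟦ χ' ⟧
  ⟦⟧-rep keep _ = refl
  ⟦⟧-rep here φ≈ψ = φ≈ψ
  ⟦⟧-rep (cong⊗ r s) φ≈ψ = ⊗-cong (⟦⟧-rep r φ≈ψ) (⟦⟧-rep s φ≈ψ)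
  ⟦⟧-rep (cong∘ r s) φ≈ψ = ∘-cong (⟦⟧-rep r φ≈ψ) (⟦⟧-rep s φ≈ψ)
  ⟦⟧-rep (cong* r) φ≈ψ = ⋆-cong (⟦⟧-rep r φ≈ψ)

  module _ {Δ : FmSet} (Δ-designated : ∀ {γ} → Δ γ → F⊥ ⟦ γ ⟧) where

    ⊢→F⊥ : ∀ {φ} → Δ ⊢I2 φ → F⊥ ⟦ φ ⟧
    ⊢→F⊥ (prem γ) = Δ-designated γ
    ⊢→F⊥ (A1 φ) = ≈→F⊥-⇒ₐ refl
    ⊢→F⊥ (A2 φ ψ) = ≈→F⊥-⇒ₐ (∘-comm _ _)
    ⊢→F⊥ (A3 φ) = ≈→F⊥-⇒ₐ (sym (⋆⋆ _))
    ⊢→F⊥ (A4 φ ψ) = ⇒-intro (cond-f _ _)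
    ⊢→F⊥ (A5 φ ψ) = to (cond-e _ _) (≈→F⊥-⇒ₐ (⊗-comm _ _) , ≈→F⊥-⇒ₐ (⊗-comm _ _))
    ⊢→F⊥ (A6 φ ψ χ) =
      ≈→F⊥-⇒ₐ (⋆-cong (trans (exch ⟦ φ ⟧ ⟦ ψ ⟧ (⟦ χ ⟧ ⋆)) (∘-cong refl (sym (⋆⋆ ⟦ ψ ⟧)))))
    ⊢→F⊥ (A7 φ ψ χ) = ⇒-intro (cond-h _ _ _)
    ⊢→F⊥ (MP d e) = ⇒-mp (⊢→F⊥ d) (⊢→F⊥ e)
    ⊢→F⊥ (Adj d e) = to (cond-e _ _) (⊢→F⊥ d , ⊢→F⊥ e)
    ⊢→F⊥ (Repl d e r) = F⊥-resp (⟦⟧-rep r (F⊥-⇔ₐ→≈ (⊢→F⊥ d))) (⊢→F⊥ e)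
    ⊢→F⊥ (Simp d) = proj₁ (from (cond-e _ _) (⊢→F⊥ d))
    ⊢→F⊥ (I2 χ d e) = I+-explosion ipM (⊢→F⊥ d) (⊢→F⊥ e) ⟦ χ ⟧

  valid : ∀ {Γ' φ} → All (λ γ → F⊥ (h γ)) Γ' → (_∈ Γ') ⊢I2 φ → F⊥ (h φ)
  valid Γ'-designated d =
    F⊥-resp (sym (h≈⟦⟧ _)) (⊢→F⊥ (λ γ∈Γ' → F⊥-resp (h≈⟦⟧ _) (All.lookup Γ'-designated γ∈Γ')) d)

sound : ∀ {Γ φ} → Γ ⊢I2 φ → Γ ⊨I+ φ
sound d with ⊢-finite d
... | Γ' , Γ'⊆Γ , d' = Γ' , Γ'⊆Γ , λ M ipM H Γ'-designated →
  Soundness.valid M ipM H Γ'-designated d'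

theorem5p5 : (Γ : FmSet) (φ : Fm) → (Γ ⊢I2 φ) ⇔ (Γ ⊨I+ φ)
theorem5p5 Γ φ = mk⇔ sound complete
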